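{- Let $s\ge1$, $t\ge 2$, $G\in\mathcal{G}_{s,t}$ with root $r$, and let $C$ be a boundary configuration on $G$ with $k$ pebble-free vertices in $S$ and distinguished even vertex $x\in T$. If $C(x)\ge k+2$, then Mover has a winning strategy.
   Context: A configuration $C$ on a graph $G$ is a function $C:V(G)\to\mathbb{Z}_{\ge 0}$. A pebbling move removes two pebbles from a vertex and places one pebble on an adjacent vertex. The Two-Player Pebbling Game on $G$ with root $r$ and starting configuration $C$ is played by Mover and Defender in rounds: in each round Mover makes a pebbling move and then Defender makes a pebbling move; each player must take their turn. If Mover pebbles from $u$ to $v$, Defender may not pebble from $v$ to $u$ in the same round. Mover wins if at any time the root has at least one pebble; Defender wins if the root has no pebble and there are no more pebbling moves. A winning strategy is a rule choosing a player's moves as a function of the current position which guarantees that player wins. For integers $s,t\ge1$, $\mathcal{G}_{s,t}$ is the class of all graphs $(K_1\cup \overline{K_t})\vee H$, where $H$ is any graph on $s$ vertices, $\overline{K_t}$ is the edgeless graph on $t$ vertices, $\cup$ is disjoint union and $\vee$ is the join. The root $r$ is the vertex of $K_1$; $S=V(H)$, $T=V(\overline{K_t})$. A configuration is non-trivial if each vertex of $S$ has 0 or 1 pebbles and the root has no pebbles. A vertex is pebble-free if it has no pebbles, pebbled otherwise; it is even or odd according to the parity of $C(v)$. $k$ is the number of pebble-free vertices of $S$, and $C_T=\sum_{v\in T}\lfloor C(v)/2\rfloor$. For $t\ge2$, a boundary configuration is a non-trivial configuration with $k$ even and $C_T=k+2$ such that there is one even vertex $x\in T$ with $C(x)\ge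 2$ and all other vertices of $T$ have an odd number of pebbles. -}

module Defs where

open import Data.Nat using (ℕ; zero; suc; _+_; _∸_; _≤_; _≥_; _/_)
open import Data.Nat.Divisibility using (_∣_)
open import Data.Fin using (Fin)
open import Data.Fin.Properties using () renaming (_≟_ to _≟ᶠ_)
open import Data.Bool using (Bool; true; false; T; if_then_else_)
open import Data.List using (List; length; filter; map; allFin)
open import Data.Nat.ListAction using (sum)
open import Data.Unit using (⊤)
open import Data.Empty using (⊥)
open import Data.Product using (Σ; _×_; _,_)
open import Relation.Nullary using (¬_; Dec; yes; no; does)
open import Relation.Binary.PropositionalEquality using (_≡_; _≢_; refl)
import Data.Nat as ℕ

Even : ℕ → Set
Even n = 2 ∣ n

Odd : ℕ → Set
Odd n = ¬ Even n

record SimpleGraph (s : ℕ) : Set where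
  field
    adj   : Fin s → Fin s → Bool
    sym   : ∀ i j → adj i j ≡ adj j i
    irref : ∀ i → adj i i ≡ false

-- Vertices of G = (K₁ ∪ K̄ₜ) ∨ H :  the root r, S = V(H) = Fin s, T = Fin t

data Vertex (s t : ℕ) : Set where
  root : Vertex s t
  sv   : Fin s → Vertex s t
  tv   : Fin t → Vertex s t

_≟ᵛ_ : ∀ {s t} (u v : Vertex s t) → Dec (u ≡ v)
root ≟ᵛ root = yes refl
root ≟ᵛ sv _ = no λ ()
root ≟ᵛ tv _ = no λ ()
sv _ ≟ᵛ root = no λ ()
sv i ≟ᵛ sv j with i ≟ᶠ j
... | yes refl = yes refl
... | no i≢j = no λ { refl → i≢j refl }
sv _ ≟ᵛ tv _ = no λ ()
tv _ ≟ᵛ root = no λ ()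
tv _ ≟ᵛ sv _ = no λ ()
tv i ≟ᵛ tv j with i ≟ᶠ j
... | yes refl = yes refl
... | no i≢j = no λ { refl → i≢j refl }

Adj : ∀ {s t} → SimpleGraph s → Vertex s t → Vertex s t → Set
Adj H root   (sv _) = ⊤
Adj H (sv _) root   = ⊤
Adj H (sv i) (sv j) = T (SimpleGraph.adj H i j)
Adj H (sv _) (tv _) = ⊤
Adj H (tv _) (sv _) = ⊤
Adj H _      _      = ⊥

Config : ℕ → ℕ → Set
Config s t = Vertex s t → ℕ

step : ∀ {s t} → Config s t → Vertex s t → Vertex s t → Config s t
step C u v w with does (w ≟ᵛ u) | does (w ≟ᵛ v)
... | true  | _     = C w ∸ 2
... | false | true  = suc (C w)
... | false | false = C w

Move : ∀ {s t} → SimpleGraph s → Config s t → Vertex s t → Vertex s t → Set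
Move H C u v = Adj H u v × 2 ≤ C u

-- MoverWins H C       : position with Mover to move, configuration C.
-- MoverWinsD H u v C  : position with Defender to move, configuration C,
--                       where Mover just pebbled from u to v (so Defender
--                       may not pebble from v to u).
-- Since every move strictly decreases the number of pebbles the game is
-- finite, and Mover has a winning strategy from a position iff the position
-- belongs to the least fixed point below (the inductive winning region).

mutual
  data MoverWins {s t} (H : SimpleGraph s) (C : Config s t) : Set where
    rootPebbled : 1 ≤ C root → MoverWins H C
    play : (u v : Vertex s t) → Move H C u v →
           MoverWinsD H u v (step C u v) → MoverWins H C

  data MoverWinsD {s t} (H : SimpleGraph s) (u v : Vertex s t) (C : Config s t) : Set where
    rootPebbledD : 1 ≤ C root → MoverWinsD H u v C
    -- Defender has at least one legal move (otherwise Defender, with an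
    -- empty root, has won), and every legal Defender move leads to a
    -- position from which Mover wins
    allReplies : Σ (Vertex s t) (λ a → Σ (Vertex s t) (λ b →
                   Move H C a b × ¬ (a ≡ v × b ≡ u))) →
                 ((a b : Vertex s t) → Move H C a b → ¬ (a ≡ v × b ≡ u) →
                   MoverWins H (step C a b)) →
                 MoverWinsD H u v C

NonTrivial : ∀ {s t} → Config s t → Set
NonTrivial {s} C = (C root ≡ 0) × ((i : Fin s) → C (sv i) ≤ 1)

pebbleFreeS : ∀ {s t} → Config s t → ℕ
pebbleFreeS {s} C = length (filter (λ i → C (sv i) ℕ.≟ 0) (allFin s))

CT : ∀ {s t} → Config s t → ℕ
CT {t = t} C = sum (map (λ j → C (tv j) / 2) (allFin t))

-- boundary configuration with distinguished even vertex x ∈ T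
-- (the definition requires t ≥ 2; this is assumed separately)
IsBoundaryWith : ∀ {s t} → Config s t → Fin t → Set
IsBoundaryWith {t = t} C x =
  NonTrivial C × Even (pebbleFreeS C) × (CT C ≡ pebbleFreeS C + 2) ×
  Even (C (tv x)) × (2 ≤ C (tv x)) ×
  ((y : Fin t) → y ≢ x → Odd (C (tv y)))

-- In a non-trivial position (root empty, at most one pebble on each
-- vertex of S) the only legal moves go from a vertex of T with at least
-- two pebbles into S, and a pebble landing on an occupied vertex of S lets
-- Mover reach the root at once.  So while a player fills a pebble-free
-- vertex of S, the opponent is forced to do the same: one round of play
-- lowers both k and C_T by two and changes each vertex of T by 0, -2 or -4.
--   * k odd, C_T ≥ k + 1: Mover fills until S is full; Defender then has to
--     double a vertex of S (odd case, 'oddFreeWins').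
--   * k = 0, C_T ≥ 2, C(x) ≥ 2, T ∖ {x} odd: Mover pebbles x onto a vertex v
--     of S; Defender must retreat from v into an odd vertex of T, which
--     restores C_T and leaves k = 1 (base case, 'fullSWins').
--   * k even: Mover fills from x while C(x) is large, otherwise from another
--     heavy vertex of T; after the round the hypotheses hold for k - 2
--     ('evenFreeWins', by induction on k / 2).

module Submission where

open import Defs
open import Data.Nat using (ℕ; zero; suc; _+_; _*_; _∸_; _/_; _≤_; _<_; z≤n; s≤s)
import Data.Nat as ℕ
open import Data.Nat.Properties
open import Data.Nat.DivMod using (m/n≡1+[m∸n]/n; m/n≢0⇒n≤m; m<n*o⇒m/o<n)
open import Data.Nat.Divisibility using (_∣_; divides; _∣0; ∣-refl; ∣m+n∣m⇒∣n; ∣m∣n⇒∣m+n)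
open import Data.Nat.ListAction using () renaming (sum to listSum)
open import Data.Nat.Tactic.RingSolver using (solve-∀)
open import Data.Fin using (Fin; zero; suc; punchIn)
open import Data.Fin.Properties using (punchInᵢ≢i) renaming (_≟_ to _≟ᶠ_)
open import Data.List using (filter; map; length; tabulate)
open import Data.Vec.Functional using (removeAt)
open import Algebra.Properties.CommutativeMonoid.Sum +-0-commutativeMonoid
  using (sum; sum-remove; sum-cong-≗)
open import Data.Bool using (T)
open import Data.Unit using (tt)
open import Data.Empty using (⊥-elim)
open import Data.Product using (Σ; _×_; _,_)
open import Data.Sum using (_⊎_; inj₁; inj₂)
open import Function using (_∘_)
open import Relation.Nullary using (¬_; Dec; yes; no; contradiction)
open import Relation.Binary.PropositionalEquality

half-suc-odd : ∀ n → Odd n → suc n / 2 ≡ suc (n / 2)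
half-suc-odd zero odd = ⊥-elim (odd (2 ∣0))
half-suc-odd (suc zero) _ = refl
half-suc-odd (suc (suc n)) odd = begin
  suc (suc (suc n)) / 2  ≡⟨ m/n≡1+[m∸n]/n {3 + n} (s≤s (s≤s z≤n)) ⟩
  suc (suc n / 2)        ≡⟨ cong suc (half-suc-odd n (odd ∘ ∣m∣n⇒∣m+n ∣-refl)) ⟩
  suc (suc (n / 2))      ≡⟨ cong suc (m/n≡1+[m∸n]/n {2 + n} (s≤s (s≤s z≤n))) ⟨
  suc (suc (suc n) / 2)  ∎
  where open ≡-Reasoning

half-positive : ∀ n → 1 ≤ n / 2 → 2 ≤ n
half-positive n pos = m/n≢0⇒n≤m (m<n⇒n≢0 pos)

-- The effect of one pebbling move on a single pile away from the moved
-- pebble: unchanged, or lowered by two.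
SameOrTwoLess : ℕ → ℕ → Set
SameOrTwoLess a b = a ≡ b ⊎ 2 + a ≡ b

same-or-two-less-even : ∀ {a b} → SameOrTwoLess a b → Even b → Even a
same-or-two-less-even (inj₁ refl) even = even
same-or-two-less-even (inj₂ eq) even = ∣m+n∣m⇒∣n (subst (2 ∣_) (sym eq) even) ∣-refl

same-or-two-less-odd : ∀ {a b} → SameOrTwoLess a b → Odd b → Odd a
same-or-two-less-odd (inj₁ refl) odd = odd
same-or-two-less-odd (inj₂ eq) odd = λ even → odd (subst (2 ∣_) eq (∣m∣n⇒∣m+n ∣-refl even))

same-or-two-less-≤ : ∀ {a b m} → SameOrTwoLess a b → 2 + m ≤ b → m ≤ a
same-or-two-less-≤ {m = m} (inj₁ refl) le = ≤-trans (m≤n+m m 2) le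
same-or-two-less-≤ (inj₂ refl) le = +-cancelˡ-≤ 2 _ _ le

sum-update : ∀ {n} (f g : Fin n → ℕ) (e : Fin n) → (∀ i → i ≢ e → f i ≡ g i) →
             sum f + g e ≡ sum g + f e
sum-update {suc n} f g e agree = begin
  sum f + g e                     ≡⟨ cong (_+ g e) (sum-remove {i = e} f) ⟩
  f e + sum (removeAt f e) + g e  ≡⟨ cong (λ r → f e + r + g e) rest ⟩
  f e + sum (removeAt g e) + g e  ≡⟨ swap-ends (f e) (sum (removeAt g e)) (g e) ⟩
  g e + sum (removeAt g e) + f e  ≡⟨ cong (_+ f e) (sum-remove {i = e} g) ⟨
  sum g + f e                     ∎
  where
    open ≡-Reasoning
    rest : sum (removeAt f e) ≡ sum (removeAt g e)
    rest = sum-cong-≗ (λ i → agree (punchIn e i) (punchInᵢ≢i e i))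
    swap-ends : ∀ a b c → a + b + c ≡ c + b + a
    swap-ends = solve-∀

term≤sum : ∀ {n} (f : Fin n → ℕ) (i : Fin n) → f i ≤ sum f
term≤sum {suc n} f i = subst (f i ≤_) (sym (sum-remove {i = i} f)) (m≤m+n _ _)

sum-positive : ∀ {n} (f : Fin n → ℕ) → 1 ≤ sum f → Σ (Fin n) λ i → 1 ≤ f i
sum-positive {suc n} f pos with f zero in eq
... | suc _ = zero , subst (1 ≤_) (sym eq) (s≤s z≤n)
... | zero with sum-positive (f ∘ suc) pos
...   | i , p = suc i , p

sum-exceeds : ∀ {n} (f : Fin n → ℕ) (x : Fin n) → f x < sum f →
              Σ (Fin n) λ j → j ≢ x × 1 ≤ f j
sum-exceeds {suc n} f x lt with sum-positive (removeAt f x) rest-positive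
  where
    rest-positive : 0 < sum (removeAt f x)
    rest-positive = +-cancelˡ-< (f x) 0 _
      (subst₂ _<_ (sym (+-identityʳ (f x))) (sum-remove {i = x} f) lt)
... | i , p = punchIn x i , punchInᵢ≢i x i , p

isFree : ℕ → ℕ
isFree zero = 1
isFree (suc _) = 0

-- Defs states k and C_T over the list allFin n = tabulate id; these two
-- lemmas turn such list expressions into finite sums.
listSum-tabulate : ∀ {n m} (h : Fin m → ℕ) (g : Fin n → Fin m) →
                   listSum (map h (tabulate g)) ≡ sum (h ∘ g)
listSum-tabulate {zero} h g = refl
listSum-tabulate {suc n} h g = cong (h (g zero) +_) (listSum-tabulate h (g ∘ suc))

countFree-tabulate : ∀ {n m} (f : Fin m → ℕ) (g : Fin n → Fin m) →
                     length (filter (λ i → f i ℕ.≟ 0) (tabulate g)) ≡ sum (isFree ∘ f ∘ g)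
countFree-tabulate {zero} f g = refl
countFree-tabulate {suc n} f g with f (g zero)
... | zero = cong suc (countFree-tabulate f (g ∘ suc))
... | suc _ = countFree-tabulate f (g ∘ suc)

module _ {s t : ℕ} where

  step-from : (C : Config s t) (u v : Vertex s t) → step C u v u ≡ C u ∸ 2
  step-from C u v with u ≟ᵛ u
  ... | yes _ = refl
  ... | no u≢u = ⊥-elim (u≢u refl)

  step-to : (C : Config s t) (u v : Vertex s t) → u ≢ v → step C u v v ≡ suc (C v)
  step-to C u v u≢v with v ≟ᵛ u | v ≟ᵛ v
  ... | yes v≡u | _ = ⊥-elim (u≢v (sym v≡u))
  ... | no _ | yes _ = refl
  ... | no _ | no v≢v = ⊥-elim (v≢v refl)

  step-elsewhere : (C : Config s t) (u v w : Vertex s t) → w ≢ u → w ≢ v → step C u v w ≡ C w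
  step-elsewhere C u v w w≢u w≢v with w ≟ᵛ u | w ≟ᵛ v
  ... | yes w≡u | _ = ⊥-elim (w≢u w≡u)
  ... | no _ | yes w≡v = ⊥-elim (w≢v w≡v)
  ... | no _ | no _ = refl

  step-keeps : (C : Config s t) (u v w : Vertex s t) → w ≢ u → C w ≤ step C u v w
  step-keeps C u v w w≢u = by-target (w ≟ᵛ v)
    where
      by-target : Dec (w ≡ v) → C w ≤ step C u v w
      by-target (yes refl) = ≤-trans (n≤1+n _) (≤-reflexive (sym (step-to C u w (w≢u ∘ sym))))
      by-target (no w≢v) = ≤-reflexive (sym (step-elsewhere C u v w w≢u w≢v))

  pebbleFree-sum : (C : Config s t) → pebbleFreeS C ≡ sum (λ i → isFree (C (sv i)))
  pebbleFree-sum C = countFree-tabulate (C ∘ sv) (λ i → i)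

  CT-sum : (C : Config s t) → CT C ≡ sum (λ j → C (tv j) / 2)
  CT-sum C = listSum-tabulate (λ j → C (tv j) / 2) (λ j → j)

  pebbleFree-update : (C C' : Config s t) (e : Fin s) → (∀ i → i ≢ e → C' (sv i) ≡ C (sv i)) →
                      pebbleFreeS C' + isFree (C (sv e)) ≡ pebbleFreeS C + isFree (C' (sv e))
  pebbleFree-update C C' e agree rewrite pebbleFree-sum C | pebbleFree-sum C' =
    sum-update _ _ e (λ i i≢e → cong isFree (agree i i≢e))

  CT-update : (C C' : Config s t) (e : Fin t) → (∀ j → j ≢ e → C' (tv j) ≡ C (tv j)) →
              CT C' + C (tv e) / 2 ≡ CT C + C' (tv e) / 2
  CT-update C C' e agree rewrite CT-sum C | CT-sum C' =
    sum-update _ _ e (λ j j≢e → cong (_/ 2) (agree j j≢e))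

  pebbleFree⇒k-positive : (C : Config s t) (i : Fin s) → C (sv i) ≡ 0 → 1 ≤ pebbleFreeS C
  pebbleFree⇒k-positive C i free =
    subst (1 ≤_) (sym (pebbleFree-sum C))
      (≤-trans (≤-reflexive (cong isFree (sym free))) (term≤sum (λ i → isFree (C (sv i))) i))

  k-positive⇒pebbleFree : (C : Config s t) → 1 ≤ pebbleFreeS C → Σ (Fin s) λ i → C (sv i) ≡ 0
  k-positive⇒pebbleFree C pos
    with sum-positive (λ i → isFree (C (sv i))) (subst (1 ≤_) (pebbleFree-sum C) pos)
  ... | i , p = i , isFree-positive (C (sv i)) p
    where
      isFree-positive : ∀ n → 1 ≤ isFree n → n ≡ 0
      isFree-positive zero _ = refl

  CT-positive⇒heavy : (C : Config s t) → 1 ≤ CT C → Σ (Fin t) λ j → 2 ≤ C (tv j)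
  CT-positive⇒heavy C pos with sum-positive (λ j → C (tv j) / 2) (subst (1 ≤_) (CT-sum C) pos)
  ... | j , p = j , half-positive (C (tv j)) p

  CT-exceeds⇒heavy : (C : Config s t) (x : Fin t) → C (tv x) / 2 < CT C →
                     Σ (Fin t) λ j → j ≢ x × 2 ≤ C (tv j)
  CT-exceeds⇒heavy C x lt with sum-exceeds (λ j → C (tv j) / 2) x (subst (_ <_) (CT-sum C) lt)
  ... | j , j≢x , p = j , j≢x , half-positive (C (tv j)) p

  CT-leaving : (C : Config s t) (j : Fin t) (e : Fin s) → 2 ≤ C (tv j) →
               suc (CT (step C (tv j) (sv e))) ≡ CT C
  CT-leaving C j e heavy = +-cancelʳ-≡ ((C (tv j) ∸ 2) / 2) _ _ (begin
    suc (CT C') + (C (tv j) ∸ 2) / 2  ≡⟨ +-suc (CT C') _ ⟨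
    CT C' + suc ((C (tv j) ∸ 2) / 2)  ≡⟨ cong (CT C' +_) (m/n≡1+[m∸n]/n heavy) ⟨
    CT C' + C (tv j) / 2              ≡⟨ CT-update C C' j agree ⟩
    CT C + C' (tv j) / 2              ≡⟨ cong (λ n → CT C + n / 2) (step-from C (tv j) (sv e)) ⟩
    CT C + (C (tv j) ∸ 2) / 2         ∎)
    where
      open ≡-Reasoning
      C' = step C (tv j) (sv e)
      agree : ∀ i → i ≢ j → C' (tv i) ≡ C (tv i)
      agree i i≢j = step-elsewhere C (tv j) (sv e) (tv i) (λ { refl → i≢j refl }) (λ ())

  CT-entering-odd : (C : Config s t) (e : Fin s) (y : Fin t) → Odd (C (tv y)) →
                    CT (step C (sv e) (tv y)) ≡ suc (CT C)
  CT-entering-odd C e y odd = +-cancelʳ-≡ (C (tv y) / 2) _ _ (begin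
    CT C' + C (tv y) / 2       ≡⟨ CT-update C C' y agree ⟩
    CT C + C' (tv y) / 2       ≡⟨ cong (λ n → CT C + n / 2) (step-to C (sv e) (tv y) (λ ())) ⟩
    CT C + suc (C (tv y)) / 2  ≡⟨ cong (CT C +_) (half-suc-odd (C (tv y)) odd) ⟩
    CT C + suc (C (tv y) / 2)  ≡⟨ +-suc (CT C) _ ⟩
    suc (CT C) + C (tv y) / 2  ∎)
    where
      open ≡-Reasoning
      C' = step C (sv e) (tv y)
      agree : ∀ i → i ≢ y → C' (tv i) ≡ C (tv i)
      agree i i≢y = step-elsewhere C (sv e) (tv y) (tv i) (λ ()) (λ { refl → i≢y refl })

  record Filled (C' C : Config s t) : Set where
    field
      nonTrivial : NonTrivial C'
      freeDrop   : suc (pebbleFreeS C') ≡ pebbleFreeS C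
      CTDrop     : suc (CT C') ≡ CT C
      TChange    : ∀ y → SameOrTwoLess (C' (tv y)) (C (tv y))
  open Filled

  fill : (C : Config s t) (j : Fin t) (e : Fin s) → NonTrivial C → C (sv e) ≡ 0 →
         2 ≤ C (tv j) → Filled (step C (tv j) (sv e)) C
  fill C j e (root-empty , atMostOne) free heavy = record
    { nonTrivial = root-empty , atMostOne'
    ; freeDrop   = freeDrop'
    ; CTDrop     = CT-leaving C j e heavy
    ; TChange    = TChange'
    }
    where
      C' = step C (tv j) (sv e)
      e-filled : C' (sv e) ≡ suc (C (sv e))
      e-filled = step-to C (tv j) (sv e) (λ ())
      S-agree : ∀ i → i ≢ e → C' (sv i) ≡ C (sv i)
      S-agree i i≢e = step-elsewhere C (tv j) (sv e) (sv i) (λ ()) (λ { refl → i≢e refl })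
      atMostOne' : ∀ i → C' (sv i) ≤ 1
      atMostOne' i = by-cases (i ≟ᶠ e)
        where
          by-cases : Dec (i ≡ e) → C' (sv i) ≤ 1
          by-cases (yes refl) = ≤-reflexive (trans e-filled (cong suc free))
          by-cases (no i≢e) = subst (_≤ 1) (sym (S-agree i i≢e)) (atMostOne i)
      freeDrop' : suc (pebbleFreeS C') ≡ pebbleFreeS C
      freeDrop' = begin
        suc (pebbleFreeS C')                 ≡⟨ +-comm 1 _ ⟩
        pebbleFreeS C' + 1                   ≡⟨ cong (λ n → pebbleFreeS C' + isFree n) free ⟨
        pebbleFreeS C' + isFree (C (sv e))   ≡⟨ pebbleFree-update C C' e S-agree ⟩
        pebbleFreeS C + isFree (C' (sv e))   ≡⟨ cong (λ n → pebbleFreeS C + isFree n) e-filled ⟩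
        pebbleFreeS C + 0                    ≡⟨ +-identityʳ _ ⟩
        pebbleFreeS C                        ∎
        where open ≡-Reasoning
      TChange' : ∀ y → SameOrTwoLess (C' (tv y)) (C (tv y))
      TChange' y = by-cases (y ≟ᶠ j)
        where
          by-cases : Dec (y ≡ j) → SameOrTwoLess (C' (tv y)) (C (tv y))
          by-cases (yes refl) = inj₂ (trans (cong (2 +_) (step-from C (tv y) (sv e))) (m+[n∸m]≡n heavy))
          by-cases (no y≢j) = inj₁ (step-elsewhere C (tv j) (sv e) (tv y) (λ { refl → y≢j refl }) (λ ()))

  round-freeDrop : ∀ {C C₁ C₂} → Filled C₁ C → Filled C₂ C₁ → 2 + pebbleFreeS C₂ ≡ pebbleFreeS C
  round-freeDrop F₁ F₂ = trans (cong suc (freeDrop F₂)) (freeDrop F₁)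

  round-CTDrop : ∀ {C C₁ C₂} → Filled C₁ C → Filled C₂ C₁ → 2 + CT C₂ ≡ CT C
  round-CTDrop F₁ F₂ = trans (cong suc (CTDrop F₂)) (CTDrop F₁)

  module Game (H : SimpleGraph s) where

    threat : (C : Config s t) (i : Fin s) → 2 ≤ C (sv i) → MoverWins H C
    threat C i two = play (sv i) root (tt , two) (rootPebbledD (s≤s z≤n))

    threat-persists : (C : Config s t) (i : Fin s) (a b : Vertex s t) → 2 ≤ C (sv i) → a ≢ sv i →
                      MoverWins H (step C a b)
    threat-persists C i a b two a≢i = threat _ i (≤-trans two (step-keeps C a b (sv i) (a≢i ∘ sym)))

    landing-on-pebbled : (C : Config s t) (a : Vertex s t) (i : Fin s) → 1 ≤ C (sv i) → a ≢ sv i →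
                         MoverWins H (step C a (sv i))
    landing-on-pebbled C a i pebbled a≢i =
      threat _ i (subst (2 ≤_) (sym (step-to C a (sv i) a≢i)) (s≤s pebbled))

    -- In a non-trivial position with C_T ≥ 1, Defender must (and can) make a
    -- move, and it either doubles a vertex of S or is a filling move.
    forced-fill : (C : Config s t) (u : Vertex s t) (e : Fin s) → NonTrivial C → 1 ≤ CT C →
                  (∀ C' → Filled C' C → MoverWins H C') → MoverWinsD H u (sv e) C
    forced-fill C u e nt@(root-empty , atMostOne) ct continue with CT-positive⇒heavy C ct
    ... | j , heavy = allReplies (tv j , sv e , (tt , heavy) , λ { (() , _) }) reply
      where
        reply : (a b : Vertex s t) → Move H C a b → ¬ (a ≡ sv e × b ≡ u) → MoverWins H (step C a b)
        reply root _ (_ , two) _ = ⊥-elim (n≮0 (≤-trans two (≤-reflexive root-empty)))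
        reply (sv i) _ (_ , two) _ = ⊥-elim (<-irrefl refl (≤-trans two (atMostOne i)))
        reply (tv _) root (() , _) _
        reply (tv _) (tv _) (() , _) _
        reply (tv j') (sv i) (_ , heavy') _ with C (sv i) ℕ.≟ 0
        ... | yes free = continue _ (fill C j' i nt free heavy')
        ... | no pebbled = landing-on-pebbled C (tv j') i (n≢0⇒n>0 pebbled) (λ ())

    fill-round : (C : Config s t) (j : Fin t) (e : Fin s) → 2 ≤ C (tv j) →
                 Filled (step C (tv j) (sv e)) C → 2 ≤ CT C →
                 (∀ C₂ → Filled C₂ (step C (tv j) (sv e)) → MoverWins H C₂) → MoverWins H C
    fill-round C j e heavy F₁ ct continue =
      play (tv j) (sv e) (tt , heavy) (forced-fill _ (tv j) e (nonTrivial F₁) ct₁ continue)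
      where
        ct₁ : 1 ≤ CT (step C (tv j) (sv e))
        ct₁ = ≤-pred (subst (2 ≤_) (sym (CTDrop F₁)) ct)

    -- Odd k with C_T ≥ k + 1: Defender is the first who cannot fill.
    oddFreeWins : (m : ℕ) (C : Config s t) → NonTrivial C → pebbleFreeS C ≡ suc (m * 2) →
                  2 + m * 2 ≤ CT C → MoverWins H C
    oddFreeWins m C nt hk hct
      with k-positive⇒pebbleFree C (subst (1 ≤_) (sym hk) (s≤s z≤n)) | CT-positive⇒heavy C (≤-trans (s≤s z≤n) hct)
    ... | e , free | j , heavy =
      fill-round C j e heavy F₁ (≤-trans (s≤s (s≤s z≤n)) hct) (after-round m hk hct)
      where
        F₁ = fill C j e nt free heavy
        after-round : (m : ℕ) → pebbleFreeS C ≡ suc (m * 2) → 2 + m * 2 ≤ CT C →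
                      ∀ C₂ → Filled C₂ (step C (tv j) (sv e)) → MoverWins H C₂
        after-round zero k≡1 _ C₂ F₂ = contradiction (trans (round-freeDrop F₁ F₂) k≡1) λ ()
        after-round (suc m) k≡3+2m ct≥4+2m C₂ F₂ =
          oddFreeWins m C₂ (nonTrivial F₂)
            (+-cancelˡ-≡ 2 _ _ (trans (round-freeDrop F₁ F₂) k≡3+2m))
            (+-cancelˡ-≤ 2 _ _ (subst (_ ≤_) (sym (round-CTDrop F₁ F₂)) ct≥4+2m))

    -- Base case k = 0: Mover doubles a vertex v of S from x; Defender's only
    -- non-losing reply sends v's pebble to an odd vertex y of T, after which
    -- k = 1 and C_T is unchanged.
    fullSWins : (x : Fin t) (v : Fin s) (C : Config s t) → NonTrivial C → pebbleFreeS C ≡ 0 →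
                2 ≤ CT C → (∀ y → y ≢ x → Odd (C (tv y))) → 2 ≤ C (tv x) → MoverWins H C
    fullSWins x v C nt@(root-empty , atMostOne) hk hct odd hx =
      play (tv x) (sv v) (tt , hx) (allReplies (sv v , root , (tt , v-doubled) , λ { (_ , ()) }) reply)
      where
        C₁ = step C (tv x) (sv v)
        pebbled : ∀ i → 1 ≤ C (sv i)
        pebbled i = n≢0⇒n>0 λ free → <-irrefl refl
          (subst (1 ≤_) hk (pebbleFree⇒k-positive C i free))
        v-one : C (sv v) ≡ 1
        v-one = ≤-antisym (atMostOne v) (pebbled v)
        v-doubled : 2 ≤ C₁ (sv v)
        v-doubled = ≤-reflexive (sym (trans (step-to C (tv x) (sv v) (λ ())) (cong suc v-one)))

        retreat : (y : Fin t) → y ≢ x → MoverWins H (step C₁ (sv v) (tv y))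
        retreat y y≢x = oddFreeWins 0 C₂ (root-empty , atMostOne₂) free₂ ct₂
          where
            C₂ = step C₁ (sv v) (tv y)
            S-agree : ∀ i → i ≢ v → C₂ (sv i) ≡ C (sv i)
            S-agree i i≢v = trans
              (step-elsewhere C₁ (sv v) (tv y) (sv i) (λ { refl → i≢v refl }) (λ ()))
              (step-elsewhere C (tv x) (sv v) (sv i) (λ ()) (λ { refl → i≢v refl }))
            v-emptied : C₂ (sv v) ≡ 0
            v-emptied = trans (step-from C₁ (sv v) (tv y)) (cong (_∸ 2) (≤-antisym
              (≤-reflexive (trans (step-to C (tv x) (sv v) (λ ())) (cong suc v-one))) v-doubled))
            atMostOne₂ : ∀ i → C₂ (sv i) ≤ 1
            atMostOne₂ i = by-cases (i ≟ᶠ v)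
              where
                by-cases : Dec (i ≡ v) → C₂ (sv i) ≤ 1
                by-cases (yes refl) = ≤-trans (≤-reflexive v-emptied) z≤n
                by-cases (no i≢v) = subst (_≤ 1) (sym (S-agree i i≢v)) (atMostOne i)
            free₂ : pebbleFreeS C₂ ≡ 1
            free₂ = +-cancelʳ-≡ 0 _ _ (begin
              pebbleFreeS C₂ + 0                  ≡⟨ cong (λ n → pebbleFreeS C₂ + isFree n) v-one ⟨
              pebbleFreeS C₂ + isFree (C (sv v))  ≡⟨ pebbleFree-update C C₂ v S-agree ⟩
              pebbleFreeS C + isFree (C₂ (sv v))  ≡⟨ cong₂ (λ k n → k + isFree n) hk v-emptied ⟩
              1 + 0                               ∎)
              where open ≡-Reasoning
            y-unchanged : C₁ (tv y) ≡ C (tv y)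
            y-unchanged = step-elsewhere C (tv x) (sv v) (tv y) (λ { refl → y≢x refl }) (λ ())
            ct₂ : 2 ≤ CT C₂
            ct₂ = subst (2 ≤_)
              (sym (trans (CT-entering-odd C₁ v y (subst Odd (sym y-unchanged) (odd y y≢x)))
                          (CT-leaving C x v hx)))
              hct

        from-v : (b : Vertex s t) → Move H C₁ (sv v) b → ¬ (sv v ≡ sv v × b ≡ tv x) →
                 MoverWins H (step C₁ (sv v) b)
        from-v root _ _ = rootPebbled (s≤s z≤n)
        from-v (sv j) (adjacent , _) _ with j ≟ᶠ v
        ... | yes refl = ⊥-elim (subst T (SimpleGraph.irref H v) adjacent)
        ... | no j≢v = landing-on-pebbled C₁ (sv v) j
          (≤-trans (pebbled j) (step-keeps C (tv x) (sv v) (sv j) (λ ())))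
          (λ { refl → j≢v refl })
        from-v (tv y) _ not-back with y ≟ᶠ x
        ... | yes refl = ⊥-elim (not-back (refl , refl))
        ... | no y≢x = retreat y y≢x

        reply : (a b : Vertex s t) → Move H C₁ a b → ¬ (a ≡ sv v × b ≡ tv x) → MoverWins H (step C₁ a b)
        reply a b move not-back = by-source (a ≟ᵛ sv v) move not-back
          where
            by-source : Dec (a ≡ sv v) → Move H C₁ a b → ¬ (a ≡ sv v × b ≡ tv x) →
                        MoverWins H (step C₁ a b)
            by-source (yes refl) = from-v b
            by-source (no a≢v) _ _ = threat-persists C₁ v a b v-doubled a≢v

    -- Mover's first filling move in the even case: from x if C(x) is large,
    -- otherwise from another vertex of T that can spare two pebbles; either
    -- way x keeps at least k + 2 pebbles.
    even-source : (n : ℕ) (C : Config s t) (x : Fin t) (e : Fin s) →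
                  2 + suc n * 2 ≤ CT C → 2 + suc n * 2 ≤ C (tv x) →
                  Σ (Fin t) λ j → 2 ≤ C (tv j) × 2 + suc n * 2 ≤ step C (tv j) (sv e) (tv x)
    even-source n C x e hct hx with 6 + n * 2 ≤? C (tv x)
    ... | yes large = x , ≤-trans (s≤s (s≤s z≤n)) hx ,
      subst (_ ≤_) (sym (step-from C (tv x) (sv e))) (∸-monoˡ-≤ 2 large)
    ... | no small with CT-exceeds⇒heavy C x half-x<CT
      where
        half-x<CT : C (tv x) / 2 < CT C
        half-x<CT = <-≤-trans (m<n*o⇒m/o<n (≰⇒> small))
          (≤-trans (s≤s (s≤s (s≤s (m≤n⇒m≤1+n (m≤m*n n 2))))) hct)
    ...   | j , j≢x , heavy = j , heavy ,
      subst (_ ≤_) (sym (step-elsewhere C (tv j) (sv e) (tv x) (λ { refl → j≢x refl }) (λ ()))) hx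

    evenFreeWins : (x : Fin t) (v : Fin s) (n : ℕ) (C : Config s t) → NonTrivial C →
                   pebbleFreeS C ≡ n * 2 → 2 + n * 2 ≤ CT C → Even (C (tv x)) →
                   (∀ y → y ≢ x → Odd (C (tv y))) → 2 + n * 2 ≤ C (tv x) → MoverWins H C
    evenFreeWins x v zero C nt hk hct _ odd hx = fullSWins x v C nt hk hct odd hx
    evenFreeWins x v (suc n) C nt hk hct even odd hx
      with k-positive⇒pebbleFree C (subst (1 ≤_) (sym hk) (s≤s z≤n))
    ... | e , free with even-source n C x e hct hx
    ...   | j , heavy , hx₁ = fill-round C j e heavy F₁ (≤-trans (s≤s (s≤s z≤n)) hct) after-round
      where
        F₁ = fill C j e nt free heavy
        after-round : ∀ C₂ → Filled C₂ (step C (tv j) (sv e)) → MoverWins H C₂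
        after-round C₂ F₂ = evenFreeWins x v n C₂ (nonTrivial F₂)
          (+-cancelˡ-≡ 2 _ _ (trans (round-freeDrop F₁ F₂) hk))
          (+-cancelˡ-≤ 2 _ _ (subst (_ ≤_) (sym (round-CTDrop F₁ F₂)) hct))
          (same-or-two-less-even (TChange F₂ x) (same-or-two-less-even (TChange F₁ x) even))
          (λ y y≢x → same-or-two-less-odd (TChange F₂ y) (same-or-two-less-odd (TChange F₁ y) (odd y y≢x)))
          (same-or-two-less-≤ (TChange F₂ x) hx₁)

-- Writing k = 2n, a boundary configuration satisfies the hypotheses of
-- 'evenFreeWins' (C_T = k + 2); S is non-empty, so it has a vertex to play on.
corollary3p17 : (s t : ℕ) → 1 ≤ s → 2 ≤ t → (H : SimpleGraph s) →
    (C : Config s t) → (x : Fin t) → IsBoundaryWith C x →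
    pebbleFreeS C + 2 ≤ C (tv x) → MoverWins H C
corollary3p17 zero t () _ H C x _ _
corollary3p17 (suc s) t _ _ H C x (nt , divides n k≡n*2 , CT≡k+2 , even , _ , odd) hx =
  Game.evenFreeWins H x zero n C nt k≡n*2 (≤-reflexive (sym (trans CT≡k+2 k+2≡2+n*2))) even odd
    (subst (_≤ C (tv x)) k+2≡2+n*2 hx)
  where
    k+2≡2+n*2 : pebbleFreeS C + 2 ≡ 2 + n * 2
    k+2≡2+n*2 = trans (+-comm _ 2) (cong (2 +_) k≡n*2)
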